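{- Let $G$ be a trigraph and $\Gamma\subseteq\operatorname{Aut}(G)$ a subgroup. For every vertex $v\in V(G)$ we have $\deg_{G/\Gamma}(v^\Gamma)\leq\deg_G(v)$. In particular, $\Delta(G/\Gamma)\leq\Delta(G)$.
   Context: A trigraph is a finite simple graph whose edges are colored red or black. $\operatorname{Aut}(G)$ denotes the automorphism group of the underlying uncolored graph of $G$ (automorphisms need not preserve colors). $v^\Gamma$ is the orbit of $v$ under $\Gamma$. For a partition $\mathcal{P}$ of $V(G)$, the quotient trigraph $G/\mathcal{P}$ has vertex set $\mathcal{P}$; two parts $U,W$ are joined by a black edge if every pair $u\in U,w\in W$ is a black edge, are non-adjacent if no such pair is an edge, and are joined by a red edge otherwise. $G/\Gamma$ denotes $G/\mathcal{P}$ where $\mathcal{P}$ is the partition of $V(G)$ into $\Gamma$-orbits. Degrees count edges of both colors; $\Delta$ is the maximum degree. -}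

module Defs where

open import Data.Nat using (ℕ; _⊔_)
open import Data.Fin using (Fin; _≟_)
open import Data.Bool using (Bool; true; false; _∧_; _∨_; not; if_then_else_)
open import Data.List using (List; length; filterᵇ; map; foldr)
open import Data.Bool.ListAction using (all; any)
open import Data.List using () renaming (allFin to allFinL)
open import Data.Product using (Σ; _×_; ∃)
open import Relation.Binary.PropositionalEquality using (_≡_)
open import Relation.Nullary.Decidable using (⌊_⌋)
open import Data.Fin.Permutation using (Permutation′; _⟨$⟩ʳ_; id; flip; _∘ₚ_)

-- Edge colours of a trigraph; `none` means non-adjacent.
data Col : Set where
  none red black : Col

isEdge : Col → Bool
isEdge none  = false
isEdge red   = true
isEdge black = true

isBlack : Col → Bool
isBlack black = true
isBlack _     = false

record Trigraph (n : ℕ) : Set where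
  field
    col   : Fin n → Fin n → Col
    sym   : ∀ u w → col u w ≡ col w u
    irrefl : ∀ u → col u u ≡ none
open Trigraph public

degC : ∀ {n} → (Fin n → Fin n → Col) → Fin n → ℕ
degC c v = length (filterᵇ (λ w → isEdge (c v w)) (allFinL _))

-- maximum degree (0 for the empty vertex set)
ΔC : ∀ {n} → (Fin n → Fin n → Col) → ℕ
ΔC c = foldr _⊔_ 0 (map (degC c) (allFinL _))

deg : ∀ {n} → Trigraph n → Fin n → ℕ
deg G = degC (col G)

Δ : ∀ {n} → Trigraph n → ℕ
Δ G = ΔC (col G)

-- automorphism of the underlying uncoloured graph
IsAut : ∀ {n} → Trigraph n → Permutation′ n → Set
IsAut G σ = ∀ u w → isEdge (col G u w) ≡ isEdge (col G (σ ⟨$⟩ʳ u) (σ ⟨$⟩ʳ w))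

record IsAutSubgroup {n} (G : Trigraph n) (Γ : Permutation′ n → Set) : Set where
  field
    ⊆Aut   : ∀ σ → Γ σ → IsAut G σ
    has-id : Γ id
    ∘-closed : ∀ σ τ → Γ σ → Γ τ → Γ (σ ∘ₚ τ)
    inv-closed : ∀ σ → Γ σ → Γ (flip σ)

InOrbit : ∀ {n} → (Permutation′ n → Set) → Fin n → Fin n → Set
InOrbit Γ v w = ∃ λ σ → Γ σ × (σ ⟨$⟩ʳ v ≡ w)

-- A partition of Fin n into m parts, given by a surjective labelling
-- `part : Fin n → Fin m` (part a = { u | part u ≡ a }).
Surjective : ∀ {n m} → (Fin n → Fin m) → Set
Surjective {n} {m} part = ∀ (a : Fin m) → ∃ λ u → part u ≡ a

IsOrbitPartition : ∀ {n m} → (Permutation′ n → Set) → (Fin n → Fin m) → Set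
IsOrbitPartition Γ part =
  Surjective part × (∀ u w → (part u ≡ part w → InOrbit Γ u w) × (InOrbit Γ u w → part u ≡ part w))

quotCol : ∀ {n m} → Trigraph n → (Fin n → Fin m) → Fin m → Fin m → Col
quotCol {n} G part a b =
  if ⌊ a ≟ b ⌋ then none
  else (if allBlack then black else (if anyEdge then red else none))
  where
    inA inB : Fin n → Bool
    inA u = ⌊ part u ≟ a ⌋
    inB w = ⌊ part w ≟ b ⌋
    allBlack anyEdge : Bool
    allBlack = all (λ u → all (λ w → not (inA u ∧ inB w) ∨ isBlack (col G u w)) (allFinL n)) (allFinL n)
    anyEdge  = any (λ u → any (λ w → inA u ∧ inB w ∧ isEdge (col G u w)) (allFinL n)) (allFinL n)

deg/ : ∀ {n m} → Trigraph n → (Fin n → Fin m) → Fin m → ℕ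
deg/ G part = degC (quotCol G part)

Δ/ : ∀ {n m} → Trigraph n → (Fin n → Fin m) → ℕ
Δ/ G part = ΔC (quotCol G part)

{-# OPTIONS --safe #-}
module Submission where

-- If the parts v^Γ and b are adjacent in G/Γ, some u ∈ v^Γ has a neighbour
-- w ∈ b. An automorphism σ ∈ Γ with σ u = v carries w to a neighbour σ w of v,
-- and σ w still lies in b because b is a Γ-orbit. Hence every neighbour of
-- v^Γ in G/Γ is the orbit of some neighbour of v, and counting gives the bound
-- on degrees; the bound on Δ follows since every part is some v^Γ.

open import Defs hiding (sym)
open import Data.Nat using (_≤_; _⊔_; suc; z≤n; s≤s)
open import Data.Nat.Properties using (≤-refl; ≤-trans; ⊔-lub; m⊔n≤o⇒m≤o; m⊔n≤o⇒n≤o; module ≤-Reasoning)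
open import Data.Fin using (Fin; _≟_)
open import Data.Fin.Permutation using (Permutation′; _⟨$⟩ʳ_)
open import Data.Bool using (Bool; true; false; T; T?; _∧_; _∨_; not; if_then_else_)
open import Data.Bool.Properties using (T-∧)
open import Data.Bool.ListAction using (all; any)
open import Data.Product using (_×_; _,_; ∃; ∃₂; proj₁; proj₂)
open import Data.Sum using (_⊎_; inj₁; inj₂)
open import Data.List using (List; []; _∷_; _++_; length; filterᵇ; map) renaming (allFin to allFinL)
open import Data.List.Properties using (length-map; foldr-preservesᵇ; foldr-forcesᵇ)
open import Data.List.Membership.Propositional using (_∈_)
open import Data.List.Membership.Propositional.Properties using (∈-∃++; ∈-allFin; ∈-map⁺; ∈-filter⁺; ∈-filter⁻)
open import Data.List.Relation.Binary.Subset.Propositional using (_⊆_)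
open import Data.List.Relation.Binary.Permutation.Propositional using (_↭_)
open import Data.List.Relation.Binary.Permutation.Propositional.Properties using (shift; ∈-resp-↭; ↭-length)
open import Data.List.Relation.Unary.Any using (here; there; satisfied)
import Data.List.Relation.Unary.All as All
import Data.List.Relation.Unary.All.Properties as All
import Data.List.Relation.Unary.Any.Properties as Any
open import Data.List.Relation.Unary.AllPairs using (_∷_)
open import Data.List.Relation.Unary.Unique.Propositional using (Unique)
import Data.List.Relation.Unary.Unique.Propositional.Properties as Unique
open import Function.Bundles using (Equivalence)
open import Function.Base using (_∘_)
open import Relation.Binary.PropositionalEquality using (_≡_; refl; sym; trans; subst)
open import Relation.Nullary.Decidable using (⌊_⌋; toWitness; fromWitness)
open import Relation.Nullary.Negation using (contradiction)

module _ {A : Set} where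

  ∈⇒↭∷ : ∀ {x : A} {ys} → x ∈ ys → ∃ λ zs → ys ↭ x ∷ zs
  ∈⇒↭∷ x∈ys with h , t , refl ← ∈-∃++ x∈ys = h ++ t , shift _ h t

  Unique-⊆⇒length≤ : ∀ {xs ys : List A} → Unique xs → xs ⊆ ys → length xs ≤ length ys
  Unique-⊆⇒length≤ {[]} _ _ = z≤n
  Unique-⊆⇒length≤ {x ∷ xs} {ys} (x∉xs ∷ uniq) xs⊆ys
    with zs , ys↭x∷zs ← ∈⇒↭∷ (xs⊆ys (here refl)) = begin
      suc (length xs) ≤⟨ s≤s (Unique-⊆⇒length≤ uniq xs⊆zs) ⟩
      suc (length zs) ≡⟨ sym (↭-length ys↭x∷zs) ⟩
      length ys       ∎
    where
    open ≤-Reasoning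
    xs⊆zs : xs ⊆ zs
    xs⊆zs z∈xs with ∈-resp-↭ ys↭x∷zs (xs⊆ys (there z∈xs))
    ... | here z≡x    = contradiction (sym z≡x) (All.lookup x∉xs z∈xs)
    ... | there z∈zs  = z∈zs

  all-all⇒ : ∀ (p : A → A → Bool) xs → T (all (λ u → all (p u) xs) xs) → ∀ {u w} → u ∈ xs → w ∈ xs → T (p u w)
  all-all⇒ p xs all-all u∈xs w∈xs = All.lookup (All.all⁺ (p _) xs (All.lookup (All.all⁺ _ xs all-all) u∈xs)) w∈xs

  any-any⇒ : ∀ (p : A → A → Bool) xs → T (any (λ u → any (p u) xs) xs) → ∃₂ λ u w → T (p u w)
  any-any⇒ p xs any-any with u , any-w ← satisfied (Any.any⁻ _ xs any-any)
                        with w , puw ← satisfied (Any.any⁻ (p u) xs any-w) = u , w , puw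

Adj : ∀ {n} → (Fin n → Fin n → Col) → Fin n → Fin n → Set
Adj c u w = T (isEdge (c u w))

NeighboursLift : ∀ {n m} → (Fin m → Fin m → Col) → (Fin n → Fin n → Col) → (Fin n → Fin m) → Fin m → Fin n → Set
NeighboursLift c d f a v = ∀ b → Adj c a b → ∃ λ w → Adj d v w × f w ≡ b

NeighboursLift⇒degC≤ : ∀ {n m} (c : Fin m → Fin m → Col) (d : Fin n → Fin n → Col) (f : Fin n → Fin m) a v →
  NeighboursLift c d f a v → degC c a ≤ degC d v
NeighboursLift⇒degC≤ {n} {m} c d f a v lift =
  subst (length Nc ≤_) (length-map f Nd) (Unique-⊆⇒length≤ (Unique.filter⁺ _ (Unique.allFin⁺ m)) Nc⊆f[Nd])
  where
  Nc Nd : List (Fin _)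
  Nc = filterᵇ (λ b → isEdge (c a b)) (allFinL m)
  Nd = filterᵇ (λ w → isEdge (d v w)) (allFinL n)
  Nc⊆f[Nd] : Nc ⊆ map f Nd
  Nc⊆f[Nd] b∈Nc
    with _ , ab ← ∈-filter⁻ (T? ∘ isEdge ∘ c a) {xs = allFinL m} b∈Nc
    with w , vw , refl ← lift _ ab = ∈-map⁺ f (∈-filter⁺ (T? ∘ isEdge ∘ d v) (∈-allFin w) vw)

degC≤ΔC : ∀ {n} (c : Fin n → Fin n → Col) v → degC c v ≤ ΔC c
degC≤ΔC c v = All.lookup (All.map⁻ degs≤ΔC) (∈-allFin v)
  where
  degs≤ΔC : All.All (_≤ ΔC c) (map (degC c) (allFinL _))
  degs≤ΔC = foldr-forcesᵇ (λ x y x⊔y≤ → m⊔n≤o⇒m≤o x y x⊔y≤ , m⊔n≤o⇒n≤o x y x⊔y≤) 0 _ ≤-refl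

ΔC-lub : ∀ {n} (c : Fin n → Fin n → Col) k → (∀ v → degC c v ≤ k) → ΔC c ≤ k
ΔC-lub c k degs≤k = foldr-preservesᵇ {P = _≤ k} {f = _⊔_} ⊔-lub {xs = map (degC c) (allFinL _)} z≤n
  (All.map⁺ (All.tabulate λ {v} _ → degs≤k v))

isEdge-if : ∀ s allBlack anyEdge →
  T (isEdge (if s then none else (if allBlack then black else (if anyEdge then red else none)))) →
  T allBlack ⊎ T anyEdge
isEdge-if false true  _    _ = inj₁ _
isEdge-if false false true _ = inj₂ _

selected-black⇒isEdge : ∀ {s t} c → T s → T t → T (not (s ∧ t) ∨ isBlack c) → T (isEdge c)
selected-black⇒isEdge {true} {true} black _ _ _ = _

module _ {n m} (G : Trigraph n) (part : Fin n → Fin m) (a b : Fin m) where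

  -- Copies of the where-bound definitions of quotCol, which are not in scope outside it;
  -- quotCol G part a b unfolds to an if-expression in these.
  private
    inA inB : Fin n → Bool
    inA u = ⌊ part u ≟ a ⌋
    inB w = ⌊ part w ≟ b ⌋
    allBlack anyEdge : Bool
    allBlack = all (λ u → all (λ w → not (inA u ∧ inB w) ∨ isBlack (col G u w)) (allFinL n)) (allFinL n)
    anyEdge  = any (λ u → any (λ w → inA u ∧ inB w ∧ isEdge (col G u w)) (allFinL n)) (allFinL n)

  quotCol-adj⇒edge : Surjective part → Adj (quotCol G part) a b →
    ∃₂ λ u w → part u ≡ a × part w ≡ b × Adj (col G) u w
  quotCol-adj⇒edge surj ab with isEdge-if ⌊ a ≟ b ⌋ allBlack anyEdge ab
  ... | inj₁ all-black
    with u , refl ← surj a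
    with w , refl ← surj b
       = u , w , refl , refl , selected-black⇒isEdge {inA u} {inB w} (col G u w) (fromWitness refl) (fromWitness refl)
           (all-all⇒ _ (allFinL n) all-black (∈-allFin u) (∈-allFin w))
  ... | inj₂ any-edge
    with u , w , sel ← any-any⇒ _ (allFinL n) any-edge
    with u∈a , w∈b,uw ← Equivalence.to (T-∧ {inA u}) sel
    with w∈b , uw ← Equivalence.to (T-∧ {inB w}) w∈b,uw
       = u , w , toWitness {a? = part u ≟ a} u∈a , toWitness {a? = part w ≟ b} w∈b , uw

orbitQuotient-NeighboursLift : ∀ {n m} (G : Trigraph n) (Γ : Permutation′ n → Set) (part : Fin n → Fin m) →
  (∀ σ → Γ σ → IsAut G σ) → IsOrbitPartition Γ part →
  ∀ v → NeighboursLift (quotCol G part) (col G) part (part v) v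
orbitQuotient-NeighboursLift G Γ part Γ⊆Aut (surj , orbits) v b adj
  with u , w , u∈v^Γ , w∈b , uw ← quotCol-adj⇒edge G part (part v) b surj adj
  with σ , σ∈Γ , refl ← proj₁ (orbits u v) u∈v^Γ
     = σ ⟨$⟩ʳ w , subst T (Γ⊆Aut σ σ∈Γ u w) uw , trans (sym w~σw) w∈b
  where
  w~σw : part w ≡ part (σ ⟨$⟩ʳ w)
  w~σw = proj₂ (orbits w (σ ⟨$⟩ʳ w)) (σ , σ∈Γ , refl)

lemma3p4 : ∀ {n m} (G : Trigraph n) (Γ : Permutation′ n → Set) (part : Fin n → Fin m) →
    IsAutSubgroup G Γ → IsOrbitPartition Γ part →
    (∀ v → deg/ G part (part v) ≤ deg G v) × (Δ/ G part ≤ Δ G)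
lemma3p4 G Γ part Γ≤AutG orbitPartition@(surj , _) = deg-bound , Δ-bound
  where
  open IsAutSubgroup Γ≤AutG using (⊆Aut)

  deg-bound : ∀ v → deg/ G part (part v) ≤ deg G v
  deg-bound v = NeighboursLift⇒degC≤ (quotCol G part) (col G) part (part v) v
    (orbitQuotient-NeighboursLift G Γ part ⊆Aut orbitPartition v)

  part-deg≤Δ : ∀ a → deg/ G part a ≤ Δ G
  part-deg≤Δ a with v , refl ← surj a = ≤-trans (deg-bound v) (degC≤ΔC (col G) v)

  Δ-bound : Δ/ G part ≤ Δ G
  Δ-bound = ΔC-lub (quotCol G part) (Δ G) part-deg≤Δ
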